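{- If the consecution $X\Rightarrow A$ is provable in $\mathbf{B}$ and $\sigma$ is an $\mathsf{rseq}$-substitution, then $\sigma^{\varepsilon}(X)\Rightarrow\sigma^{\varepsilon}(A)$ is provable in $\mathbf{B}$.
   Context: Language: atoms $\mathsf{At}$; formulas built by $\neg,\land,\lor,\to,\circ$; bunches built from formulas by comma $(X,Y)$ and semicolon $(X;Y)$; a consecution is $X\Rightarrow A$. $Y(X)$ denotes $Y$ with a distinguished occurrence of subbunch $X$, $Y(Z)$ the replacement by $Z$. Sequences: $\mathsf{seq}$ = finite sequences over $\{l,r,\lambda,\rho,n\}$, juxtaposition = concatenation, $\varepsilon$ empty. One-step reduction: $\overline{a}l\lambda\overline{b}\rightsquigarrow'\overline{a}\rho\overline{b}$; $\overline{a}r\lambda\overline{b}\rightsquigarrow'\overline{a}\overline{b}$; $\overline{a}\lambda r\overline{b}\rightsquigarrow'\overline{a}\overline{b}$; $\overline{a}\rho r\overline{b}\rightsquigarrow'\overline{a}l\overline{b}$; $\overline{a}nn\overline{b}\rightsquigarrow'\overline{a}\overline{b}$. $\mathsf{rseq}$ = reduced sequences (no step applies); $\mathsf{red}(\overline{a})$ = the unique reduced sequence reachable from $\overline{a}$ by finitely many steps. An $\mathsf{rseq}$-substitution is $\sigma:\mathsf{rseq}\times\mathsf{At}\to$ formulas, extended to bunches by $\sigma^{\overline{a}}(A\land B)=\sigma^{\overline{a}}(A)\land\sigma^{\overline{a}}(B)$, $\sigma^{\overline{a}}(A\lor B)=\sigma^{\overline{a}}(A)\lor\sigma^{\overline{a}}(B)$,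 $\sigma^{\overline{a}}(\neg A)=\neg\sigma^{\mathsf{red}(n\overline{a})}(A)$, $\sigma^{\overline{a}}(A\to B)=\sigma^{\mathsf{red}(l\overline{a})}(A)\to\sigma^{\mathsf{red}(r\overline{a})}(B)$, $\sigma^{\overline{a}}(A\circ B)=\sigma^{\mathsf{red}(\lambda\overline{a})}(A)\circ\sigma^{\mathsf{red}(\rho\overline{a})}(B)$, $\sigma^{\overline{a}}(X,Y)=\sigma^{\overline{a}}(X),\sigma^{\overline{a}}(Y)$, $\sigma^{\overline{a}}(X;Y)=\sigma^{\mathsf{red}(\lambda\overline{a})}(X);\sigma^{\mathsf{red}(\rho\overline{a})}(Y)$. Rules of $\mathbf{B}$ (premises / conclusion): (id): $A\Rightarrow A$. ($\to$I): $X;A\Rightarrow B$ / $X\Rightarrow A\to B$. ($\to$E): $X\Rightarrow A\to B$, $Y\Rightarrow A$ / $X;Y\Rightarrow B$. ($\lor$I$_1$): $X\Rightarrow A$ / $X\Rightarrow A\lor B$. ($\lor$I$_2$): $X\Rightarrow B$ / $X\Rightarrow A\lor B$. ($\lor$E): $X\Rightarrow A\lor B$, $Y(A)\Rightarrow C$, $Y(B)\Rightarrow C$ / $Y(X)\Rightarrow C$. ($\land$I): $X\Rightarrow A$, $Y\Rightarrow B$ / $X,Y\Rightarrow A\land B$. ($\land$E): $X\Rightarrow A\land B$, $Y(A,B)\Rightarrow C$ / $Y(X)\Rightarrow C$. ($\circ$I): $X\Rightarrow A$, $Y\Rightarrow B$ / $X;Y\Rightarrow A\circ B$. ($\circ$E):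 $X\Rightarrow A\circ B$, $Y(A;B)\Rightarrow C$ / $Y(X)\Rightarrow C$. ($\neg$I): $X\Rightarrow B$, $A\Rightarrow\neg B$ / $X\Rightarrow\neg A$. ($\neg$E): $X\Rightarrow\neg\neg A$ / $X\Rightarrow A$. (Cut): $X\Rightarrow A$, $Y(A)\Rightarrow B$ / $Y(X)\Rightarrow B$. Structural: $W(X,(Y,Z))\Rightarrow A$ / $W((X,Y),Z)\Rightarrow A$; $W(X,Y)\Rightarrow A$ / $W(Y,X)\Rightarrow A$; $W(X,X)\Rightarrow A$ / $W(X)\Rightarrow A$; $W(X)\Rightarrow A$ / $W(X,Y)\Rightarrow A$. A consecution is provable in $\mathbf{B}$ if it is the root of a finite derivation tree built from these rules whose leaves are all (id) instances. -}

module Defs where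

open import Data.List using (List; []; _∷_)
open import Data.Product using (Σ; _,_; proj₁; proj₂; _×_)
open import Data.Unit using (⊤; tt)
open import Data.Empty using (⊥)

infixr 6 _∧'_ _∨'_
infixr 5 _⇒'_
infixr 7 _∘'_

data Formula (At : Set) : Set where
  atom  : At → Formula At
  ¬'_   : Formula At → Formula At
  _∧'_  : Formula At → Formula At → Formula At
  _∨'_  : Formula At → Formula At → Formula At
  _⇒'_  : Formula At → Formula At → Formula At
  _∘'_  : Formula At → Formula At → Formula At

data Bunch (At : Set) : Set where
  fm    : Formula At → Bunch At
  _⸴_   : Bunch At → Bunch At → Bunch At
  _⨾_   : Bunch At → Bunch At → Bunch At

data Ctx (At : Set) : Set where
  hole : Ctx At
  _⸴ₗ_ : Ctx At → Bunch At → Ctx At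
  _⸴ᵣ_ : Bunch At → Ctx At → Ctx At
  _⨾ₗ_ : Ctx At → Bunch At → Ctx At
  _⨾ᵣ_ : Bunch At → Ctx At → Ctx At

_[_] : ∀ {At} → Ctx At → Bunch At → Bunch At
hole      [ X ] = X
(C ⸴ₗ Y) [ X ] = (C [ X ]) ⸴ Y
(Y ⸴ᵣ C) [ X ] = Y ⸴ (C [ X ])
(C ⨾ₗ Y) [ X ] = (C [ X ]) ⨾ Y
(Y ⨾ᵣ C) [ X ] = Y ⨾ (C [ X ])

infix 2 _⊢_

data _⊢_ {At : Set} : Bunch At → Formula At → Set where
  id   : ∀ {A} → fm A ⊢ A
  →I   : ∀ {X A B} → (X ⨾ fm A) ⊢ B → X ⊢ A ⇒' B
  →E   : ∀ {X Y A B} → X ⊢ A ⇒' B → Y ⊢ A → (X ⨾ Y) ⊢ B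
  ∨I₁  : ∀ {X A B} → X ⊢ A → X ⊢ A ∨' B
  ∨I₂  : ∀ {X A B} → X ⊢ B → X ⊢ A ∨' B
  ∨E   : ∀ {X A B C} (Y : Ctx At) → X ⊢ A ∨' B → Y [ fm A ] ⊢ C → Y [ fm B ] ⊢ C → Y [ X ] ⊢ C
  ∧I   : ∀ {X Y A B} → X ⊢ A → Y ⊢ B → (X ⸴ Y) ⊢ A ∧' B
  ∧E   : ∀ {X A B C} (Y : Ctx At) → X ⊢ A ∧' B → Y [ fm A ⸴ fm B ] ⊢ C → Y [ X ] ⊢ C
  ∘I   : ∀ {X Y A B} → X ⊢ A → Y ⊢ B → (X ⨾ Y) ⊢ A ∘' B
  ∘E   : ∀ {X A B C} (Y : Ctx At) → X ⊢ A ∘' B → Y [ fm A ⨾ fm B ] ⊢ C → Y [ X ] ⊢ C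
  ¬I   : ∀ {X A B} → X ⊢ B → fm A ⊢ ¬' B → X ⊢ ¬' A
  ¬E   : ∀ {X A} → X ⊢ ¬' (¬' A) → X ⊢ A
  cut  : ∀ {X A B} (Y : Ctx At) → X ⊢ A → Y [ fm A ] ⊢ B → Y [ X ] ⊢ B
  assoc : ∀ {X Y Z A} (W : Ctx At) → W [ X ⸴ (Y ⸴ Z) ] ⊢ A → W [ (X ⸴ Y) ⸴ Z ] ⊢ A
  comm  : ∀ {X Y A} (W : Ctx At) → W [ X ⸴ Y ] ⊢ A → W [ Y ⸴ X ] ⊢ A
  contr : ∀ {X A} (W : Ctx At) → W [ X ⸴ X ] ⊢ A → W [ X ] ⊢ A
  weak  : ∀ {X Y A} (W : Ctx At) → W [ X ] ⊢ A → W [ X ⸴ Y ] ⊢ A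

data Sym : Set where
  l r lam rho n : Sym

-- Ok x y : the adjacent pair x y is not the redex of any one-step reduction
-- (redexes: l λ, r λ, λ r, ρ r, n n)
Ok : Sym → Sym → Set
Ok l   lam = ⊥
Ok r   lam = ⊥
Ok lam r   = ⊥
Ok rho r   = ⊥
Ok n   n   = ⊥
Ok _   _   = ⊤

Reduced : List Sym → Set
Reduced []           = ⊤
Reduced (x ∷ [])     = ⊤
Reduced (x ∷ y ∷ t)  = Ok x y × Reduced (y ∷ t)

RSeq : Set
RSeq = Σ (List Sym) Reduced

ε : RSeq
ε = [] , tt

private
  tl : ∀ {x t} → Reduced (x ∷ t) → Reduced t
  tl {t = []} _ = tt
  tl {t = y ∷ t} (_ , p) = p

  ρλ : ∀ {b} → Reduced (lam ∷ b) → Reduced (rho ∷ b)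
  ρλ {[]} _ = tt
  ρλ {l ∷ t} (o , p) = tt , p
  ρλ {r ∷ t} (() , p)
  ρλ {lam ∷ t} (o , p) = tt , p
  ρλ {rho ∷ t} (o , p) = tt , p
  ρλ {n ∷ t} (o , p) = tt , p

  lr : ∀ {b} → Reduced (r ∷ b) → Reduced (l ∷ b)
  lr {[]} _ = tt
  lr {l ∷ t} (o , p) = tt , p
  lr {r ∷ t} (o , p) = tt , p
  lr {lam ∷ t} (() , p)
  lr {rho ∷ t} (o , p) = tt , p
  lr {n ∷ t} (o , p) = tt , p

-- push x a = red (x a) for a reduced sequence a
push : Sym → RSeq → RSeq
push x   ([] , _)        = x ∷ [] , tt
push l   (lam ∷ b , p)   = rho ∷ b , ρλ p
push r   (lam ∷ b , p)   = b , tl p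
push lam (r ∷ b , p)     = b , tl p
push rho (r ∷ b , p)     = l ∷ b , lr p
push n   (n ∷ b , p)     = b , tl p
push l   (y@l ∷ b , p)   = l ∷ y ∷ b , tt , p
push l   (y@r ∷ b , p)   = l ∷ y ∷ b , tt , p
push l   (y@rho ∷ b , p) = l ∷ y ∷ b , tt , p
push l   (y@n ∷ b , p)   = l ∷ y ∷ b , tt , p
push r   (y@l ∷ b , p)   = r ∷ y ∷ b , tt , p
push r   (y@r ∷ b , p)   = r ∷ y ∷ b , tt , p
push r   (y@rho ∷ b , p) = r ∷ y ∷ b , tt , p
push r   (y@n ∷ b , p)   = r ∷ y ∷ b , tt , p
push lam (y@l ∷ b , p)   = lam ∷ y ∷ b , tt , p
push lam (y@lam ∷ b , p) = lam ∷ y ∷ b , tt , p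
push lam (y@rho ∷ b , p) = lam ∷ y ∷ b , tt , p
push lam (y@n ∷ b , p)   = lam ∷ y ∷ b , tt , p
push rho (y@l ∷ b , p)   = rho ∷ y ∷ b , tt , p
push rho (y@lam ∷ b , p) = rho ∷ y ∷ b , tt , p
push rho (y@rho ∷ b , p) = rho ∷ y ∷ b , tt , p
push rho (y@n ∷ b , p)   = rho ∷ y ∷ b , tt , p
push n   (y@l ∷ b , p)   = n ∷ y ∷ b , tt , p
push n   (y@r ∷ b , p)   = n ∷ y ∷ b , tt , p
push n   (y@lam ∷ b , p) = n ∷ y ∷ b , tt , p
push n   (y@rho ∷ b , p) = n ∷ y ∷ b , tt , p

-- red a : the (unique) reduced sequence reachable from a,
-- computed by normalising from the right
red : List Sym → RSeq
red []      = ε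
red (x ∷ a) = push x (red a)

Subst : Set → Set
Subst At = RSeq → At → Formula At

_·_ : Sym → RSeq → RSeq
x · a = red (x ∷ proj₁ a)

substF : ∀ {At} → Subst At → RSeq → Formula At → Formula At
substF σ a (atom p) = σ a p
substF σ a (¬' A)   = ¬' substF σ (n · a) A
substF σ a (A ∧' B) = substF σ a A ∧' substF σ a B
substF σ a (A ∨' B) = substF σ a A ∨' substF σ a B
substF σ a (A ⇒' B) = substF σ (l · a) A ⇒' substF σ (r · a) B
substF σ a (A ∘' B) = substF σ (lam · a) A ∘' substF σ (rho · a) B

substB : ∀ {At} → Subst At → RSeq → Bunch At → Bunch At
substB σ a (fm A)  = fm (substF σ a A)
substB σ a (X ⸴ Y) = substB σ a X ⸴ substB σ a Y
substB σ a (X ⨾ Y) = substB σ (lam · a) X ⨾ substB σ (rho · a) Y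

{-# OPTIONS --safe #-}
-- Induction on derivations, proving σ^a(X) ⇒ σ^a(A) for every reduced a at once.
-- The sequences that a rule relates are the two sides of a defining reduction:
-- →I and →E pass through λ(r a), ρ(r a) and l(λ a), r(λ a), which reduce to
-- a, l a and ρ a, a, and ¬I, ¬E through n(n a), which reduces to a; so σ^a maps
-- each rule instance to an instance of the same rule. For the context rules,
-- σ^a(Y(X)) is a substituted context filled with σ^b(X), b the sequence at the hole.
module Submission where

open import Defs
open import Data.List using ([]; _∷_)
open import Data.Product using (_,_; proj₁)
open import Data.Unit using (tt)
open import Relation.Binary.PropositionalEquality
  using (_≡_; refl; sym; trans; cong; subst; subst₂)

push-∷ : ∀ x y t (o : Ok x y) (p : Reduced (y ∷ t)) → push x (y ∷ t , p) ≡ (x ∷ y ∷ t , o , p)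
push-∷ l   l   t o p = refl
push-∷ l   r   t o p = refl
push-∷ l   lam t () p
push-∷ l   rho t o p = refl
push-∷ l   n   t o p = refl
push-∷ r   l   t o p = refl
push-∷ r   r   t o p = refl
push-∷ r   lam t () p
push-∷ r   rho t o p = refl
push-∷ r   n   t o p = refl
push-∷ lam l   t o p = refl
push-∷ lam r   t () p
push-∷ lam lam t o p = refl
push-∷ lam rho t o p = refl
push-∷ lam n   t o p = refl
push-∷ rho l   t o p = refl
push-∷ rho r   t () p
push-∷ rho lam t o p = refl
push-∷ rho rho t o p = refl
push-∷ rho n   t o p = refl
push-∷ n   l   t o p = refl
push-∷ n   r   t o p = refl
push-∷ n   lam t o p = refl
push-∷ n   rho t o p = refl
push-∷ n   n   t () p

red-proj₁ : (a : RSeq) → red (proj₁ a) ≡ a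
red-proj₁ ([] , tt) = refl
red-proj₁ (x ∷ [] , tt) = refl
red-proj₁ (x ∷ y ∷ t , o , p) =
  trans (cong (push x) (red-proj₁ (y ∷ t , p))) (push-∷ x y t o p)

·-push : ∀ x a → x · a ≡ push x a
·-push x a = cong (push x) (red-proj₁ a)

·²-push : ∀ x y a → x · (y · a) ≡ push x (push y a)
·²-push x y a = trans (·-push x (y · a)) (cong (push x) (·-push y a))

push-lλ : (a : RSeq) → push l (push lam a) ≡ push rho a
push-lλ ([] , _) = refl
push-lλ (r ∷ [] , _) = refl
push-lλ (r ∷ l ∷ t , _) = refl
push-lλ (r ∷ r ∷ t , _) = refl
push-lλ (r ∷ lam ∷ t , () , _)
push-lλ (r ∷ rho ∷ t , _) = refl
push-lλ (r ∷ n ∷ t , _) = refl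
push-lλ (l ∷ t , _) = refl
push-lλ (lam ∷ t , _) = refl
push-lλ (rho ∷ t , _) = refl
push-lλ (n ∷ t , _) = refl

push-rλ : (a : RSeq) → push r (push lam a) ≡ a
push-rλ ([] , _) = refl
push-rλ (r ∷ [] , _) = refl
push-rλ (r ∷ l ∷ t , _) = refl
push-rλ (r ∷ r ∷ t , _) = refl
push-rλ (r ∷ lam ∷ t , () , _)
push-rλ (r ∷ rho ∷ t , _) = refl
push-rλ (r ∷ n ∷ t , _) = refl
push-rλ (l ∷ t , _) = refl
push-rλ (lam ∷ t , _) = refl
push-rλ (rho ∷ t , _) = refl
push-rλ (n ∷ t , _) = refl

push-λr : (a : RSeq) → push lam (push r a) ≡ a
push-λr ([] , _) = refl
push-λr (lam ∷ [] , _) = refl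
push-λr (lam ∷ l ∷ t , _) = refl
push-λr (lam ∷ r ∷ t , () , _)
push-λr (lam ∷ lam ∷ t , _) = refl
push-λr (lam ∷ rho ∷ t , _) = refl
push-λr (lam ∷ n ∷ t , _) = refl
push-λr (l ∷ t , _) = refl
push-λr (r ∷ t , _) = refl
push-λr (rho ∷ t , _) = refl
push-λr (n ∷ t , _) = refl

push-ρr : (a : RSeq) → push rho (push r a) ≡ push l a
push-ρr ([] , _) = refl
push-ρr (lam ∷ [] , _) = refl
push-ρr (lam ∷ l ∷ t , _) = refl
push-ρr (lam ∷ r ∷ t , () , _)
push-ρr (lam ∷ lam ∷ t , _) = refl
push-ρr (lam ∷ rho ∷ t , _) = refl
push-ρr (lam ∷ n ∷ t , _) = refl
push-ρr (l ∷ t , _) = refl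
push-ρr (r ∷ t , _) = refl
push-ρr (rho ∷ t , _) = refl
push-ρr (n ∷ t , _) = refl

push-nn : (a : RSeq) → push n (push n a) ≡ a
push-nn ([] , _) = refl
push-nn (n ∷ [] , _) = refl
push-nn (n ∷ l ∷ t , _) = refl
push-nn (n ∷ r ∷ t , _) = refl
push-nn (n ∷ lam ∷ t , _) = refl
push-nn (n ∷ rho ∷ t , _) = refl
push-nn (n ∷ n ∷ t , () , _)
push-nn (l ∷ t , _) = refl
push-nn (r ∷ t , _) = refl
push-nn (lam ∷ t , _) = refl
push-nn (rho ∷ t , _) = refl

·-lλ : ∀ a → l · (lam · a) ≡ rho · a
·-lλ a = trans (·²-push l lam a) (trans (push-lλ a) (sym (·-push rho a)))

·-rλ : ∀ a → r · (lam · a) ≡ a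
·-rλ a = trans (·²-push r lam a) (push-rλ a)

·-λr : ∀ a → lam · (r · a) ≡ a
·-λr a = trans (·²-push lam r a) (push-λr a)

·-ρr : ∀ a → rho · (r · a) ≡ l · a
·-ρr a = trans (·²-push rho r a) (trans (push-ρr a) (sym (·-push l a)))

·-nn : ∀ a → n · (n · a) ≡ a
·-nn a = trans (·²-push n n a) (push-nn a)

module _ {At : Set} (σ : Subst At) where

  substC : RSeq → Ctx At → Ctx At
  substC a hole     = hole
  substC a (C ⸴ₗ Y) = substC a C ⸴ₗ substB σ a Y
  substC a (Y ⸴ᵣ C) = substB σ a Y ⸴ᵣ substC a C
  substC a (C ⨾ₗ Y) = substC (lam · a) C ⨾ₗ substB σ (rho · a) Y
  substC a (Y ⨾ᵣ C) = substB σ (lam · a) Y ⨾ᵣ substC (rho · a) C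

  holeSeq : RSeq → Ctx At → RSeq
  holeSeq a hole     = a
  holeSeq a (C ⸴ₗ Y) = holeSeq a C
  holeSeq a (Y ⸴ᵣ C) = holeSeq a C
  holeSeq a (C ⨾ₗ Y) = holeSeq (lam · a) C
  holeSeq a (Y ⨾ᵣ C) = holeSeq (rho · a) C

  substB-[] : ∀ a C X → substB σ a (C [ X ]) ≡ substC a C [ substB σ (holeSeq a C) X ]
  substB-[] a hole     X = refl
  substB-[] a (C ⸴ₗ Y) X = cong (_⸴ substB σ a Y) (substB-[] a C X)
  substB-[] a (Y ⸴ᵣ C) X = cong (substB σ a Y ⸴_) (substB-[] a C X)
  substB-[] a (C ⨾ₗ Y) X = cong (_⨾ substB σ (rho · a) Y) (substB-[] (lam · a) C X)
  substB-[] a (Y ⨾ᵣ C) X = cong (substB σ (lam · a) Y ⨾_) (substB-[] (rho · a) C X)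

  ⊢-substB-[] : ∀ {a} C {X B} →
    substB σ a (C [ X ]) ⊢ B → substC a C [ substB σ (holeSeq a C) X ] ⊢ B
  ⊢-substB-[] {a} C {X} {B} = subst (_⊢ B) (substB-[] a C X)

  ⊢-substB-[]⁻¹ : ∀ {a} C {X B} →
    substC a C [ substB σ (holeSeq a C) X ] ⊢ B → substB σ a (C [ X ]) ⊢ B
  ⊢-substB-[]⁻¹ {a} C {X} {B} = subst (_⊢ B) (sym (substB-[] a C X))

  ⊢-substB : ∀ a {X A} → X ⊢ A → substB σ a X ⊢ substF σ a A
  ⊢-substB a id = id
  ⊢-substB a (→I {X} {A} {B} d) =
    →I (subst₂ (λ u v → substB σ u X ⨾ fm (substF σ v A) ⊢ substF σ (r · a) B)
               (·-λr a) (·-ρr a) (⊢-substB (r · a) d))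
  ⊢-substB a (→E {X} {Y} {A} {B} d e) =
    →E (subst₂ (λ u v → substB σ (lam · a) X ⊢ substF σ u A ⇒' substF σ v B)
               (·-lλ a) (·-rλ a) (⊢-substB (lam · a) d))
       (⊢-substB (rho · a) e)
  ⊢-substB a (∨I₁ d) = ∨I₁ (⊢-substB a d)
  ⊢-substB a (∨I₂ d) = ∨I₂ (⊢-substB a d)
  ⊢-substB a (∨E Y d e f) =
    ⊢-substB-[]⁻¹ Y (∨E (substC a Y) (⊢-substB (holeSeq a Y) d)
                        (⊢-substB-[] Y (⊢-substB a e)) (⊢-substB-[] Y (⊢-substB a f)))
  ⊢-substB a (∧I d e) = ∧I (⊢-substB a d) (⊢-substB a e)
  ⊢-substB a (∧E Y d e) =
    ⊢-substB-[]⁻¹ Y (∧E (substC a Y) (⊢-substB (holeSeq a Y) d) (⊢-substB-[] Y (⊢-substB a e)))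
  ⊢-substB a (∘I d e) = ∘I (⊢-substB (lam · a) d) (⊢-substB (rho · a) e)
  ⊢-substB a (∘E Y d e) =
    ⊢-substB-[]⁻¹ Y (∘E (substC a Y) (⊢-substB (holeSeq a Y) d) (⊢-substB-[] Y (⊢-substB a e)))
  ⊢-substB a (¬I {A = A} {B} d e) =
    ¬I (⊢-substB a d)
       (subst (λ u → fm (substF σ (n · a) A) ⊢ ¬' substF σ u B) (·-nn a) (⊢-substB (n · a) e))
  ⊢-substB a (¬E {X} {A} d) =
    ¬E (subst (λ u → substB σ a X ⊢ ¬' ¬' substF σ u A) (·-nn a) (⊢-substB a d))
  ⊢-substB a (cut Y d e) =
    ⊢-substB-[]⁻¹ Y (cut (substC a Y) (⊢-substB (holeSeq a Y) d) (⊢-substB-[] Y (⊢-substB a e)))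
  ⊢-substB a (assoc W d) = ⊢-substB-[]⁻¹ W (assoc (substC a W) (⊢-substB-[] W (⊢-substB a d)))
  ⊢-substB a (comm W d)  = ⊢-substB-[]⁻¹ W (comm (substC a W) (⊢-substB-[] W (⊢-substB a d)))
  ⊢-substB a (contr W d) = ⊢-substB-[]⁻¹ W (contr (substC a W) (⊢-substB-[] W (⊢-substB a d)))
  ⊢-substB a (weak W d)  = ⊢-substB-[]⁻¹ W (weak (substC a W) (⊢-substB-[] W (⊢-substB a d)))

corollary42 : {At : Set} (X : Bunch At) (A : Formula At) → X ⊢ A →
    (σ : Subst At) → substB σ ε X ⊢ substF σ ε A
corollary42 X A d σ = ⊢-substB σ ε d
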